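{- Let $G$ be a graph with $n$ vertices. Then $\phi(G)\geq \dfrac{n}{\bar{\alpha}(G)}\geq \dfrac{n}{n-d(G)}$.
   Context: All graphs are finite and simple; $N(v)$ is the open neighborhood of $v$. An independent set $F$ of $G$ is a free independent set if it is contained in at least two distinct maximal independent sets of $G$ (equivalently, there is an edge $uv$ with $(N(u)\cup N(v))\cap F=\emptyset$). $G$ is free if every vertex lies in some free independent set. The free chromatic number $\phi(G)$ is the minimum $t$ such that $V(G)$ can be partitioned into $t$ free independent sets; $\phi(G)=\infty$ if $G$ is not free. $\bar{\alpha}(G)$ denotes the maximum size of a free independent set of $G$. For an edge $e=uv$, $d(e)=|N(u)\cup N(v)|$, and $d(G)=\min\{d(e): e\in E(G)\}$. -}

module Defs where

open import Data.Nat using (ℕ; _≤_)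
open import Data.Bool using (Bool; true; false)
open import Data.Fin using (Fin)
open import Data.Fin.Subset using (Subset; _∈_; _⊆_; _∪_; ∣_∣)
open import Data.Vec using (tabulate)
open import Data.Product using (Σ; ∃; _×_)
open import Relation.Binary.PropositionalEquality using (_≡_; _≢_)
open import Relation.Nullary using (¬_)
open import Relation.Nullary.Decidable using (⌊_⌋)
open import Data.Fin using (_≟_)

record Graph (n : ℕ) : Set where
  field
    adj   : Fin n → Fin n → Bool
    sym   : ∀ u v → adj u v ≡ adj v u
    irrefl : ∀ v → adj v v ≡ false

module _ {n : ℕ} (G : Graph n) where
  open Graph G

  Edge : Fin n → Fin n → Set
  Edge u v = adj u v ≡ true

  N : Fin n → Subset n
  N v = tabulate (adj v)

  edgeDeg : Fin n → Fin n → ℕ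
  edgeDeg u v = ∣ N u ∪ N v ∣

  Independent : Subset n → Set
  Independent F = ∀ u v → u ∈ F → v ∈ F → ¬ Edge u v

  MaximalIndependent : Subset n → Set
  MaximalIndependent M =
    Independent M × (∀ M′ → Independent M′ → M ⊆ M′ → M′ ≡ M)

  FreeIndependent : Subset n → Set
  FreeIndependent F =
    Independent F ×
    Σ (Subset n) λ M₁ → Σ (Subset n) λ M₂ →
      MaximalIndependent M₁ × MaximalIndependent M₂ × M₁ ≢ M₂ × F ⊆ M₁ × F ⊆ M₂

  colourClass : {t : ℕ} → (Fin n → Fin t) → Fin t → Subset n
  colourClass c i = tabulate (λ v → ⌊ c v ≟ i ⌋)

  -- V(G) can be partitioned into t (nonempty) free independent sets,
  -- given as the colour classes of a surjective colouring c.
  FreePartition : ℕ → Set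
  FreePartition t =
    Σ (Fin n → Fin t) λ c →
      (∀ i → ∃ λ v → c v ≡ i) × (∀ i → FreeIndependent (colourClass c i))

  IsFreeChromaticNumber : ℕ → Set
  IsFreeChromaticNumber t = FreePartition t × (∀ s → FreePartition s → t ≤ s)

  IsFreeIndepNumber : ℕ → Set
  IsFreeIndepNumber a =
    (∃ λ F → FreeIndependent F × ∣ F ∣ ≡ a) ×
    (∀ F → FreeIndependent F → ∣ F ∣ ≤ a)

  IsMinEdgeDeg : ℕ → Set
  IsMinEdgeDeg δ =
    (∃ λ u → ∃ λ v → Edge u v × edgeDeg u v ≡ δ) ×
    (∀ u v → Edge u v → δ ≤ edgeDeg u v)

-- Each colour class of a free partition is a free independent set, so it has at most ᾱ(G)
-- vertices, and n ≤ φ(G) ᾱ(G). A free independent set F lies in two distinct maximal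
-- independent sets M₁ ≠ M₂; take x ∈ M₁ ∖ M₂. By maximality x has a neighbour y ∈ M₂, and
-- F ⊆ M₁ ∩ M₂ avoids N(x) ∪ N(y), so |F| ≤ n − d(xy) ≤ n − d(G).
module Submission where

open import Defs
open import Data.Nat.Properties
  using (+-0-commutativeMonoid; +-mono-≤; *-monoʳ-≤; ∸-monoʳ-≤; module ≤-Reasoning)
open import Algebra.Properties.CommutativeMonoid.Sum +-0-commutativeMonoid
  using (sum-syntax; sum-cong-≗; sum-replicate-zero; ∑-distrib-+)
open import Data.Bool using (Bool; true; false)
import Data.Bool.Properties as Bool
open import Data.Empty using (⊥-elim)
open import Data.Fin using (Fin; zero; suc; _≟_)
open import Data.Fin.Properties using (any?)
open import Data.Fin.Subset using (Subset; _∈_; _∉_; _⊆_; _∪_; ∁; ⁅_⁆; ∣_∣)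
open import Data.Fin.Subset.Properties
  using (_∈?_; x∈p∪q⁻; p⊆p∪q; q⊆p∪q; x∈⁅x⁆; x∈⁅y⁆⇒x≡y; x∉p⇒x∈∁p; p⊆q⇒∣p∣≤∣q∣; ∣∁p∣≡n∸∣p∣)
open import Data.Nat using (ℕ; zero; suc; _+_; _*_; _∸_; _≤_; z≤n)
open import Data.Product using (_×_; _,_; ∃; proj₁)
open import Data.Sum using (inj₁; inj₂)
open import Data.Vec using (_∷_; tabulate)
open import Data.Vec.Properties using ([]=⇒lookup; lookup∘tabulate)
open import Function using (_∘_)
open import Relation.Binary.PropositionalEquality
open import Relation.Nullary using (¬_; yes; no)
open import Relation.Nullary.Decidable using (⌊_⌋; _×-dec_; ¬?)

indicator : Bool → ℕ
indicator true  = 1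
indicator false = 0

∣x∷p∣≡indicator[x]+∣p∣ : ∀ {n} x (p : Subset n) → ∣ x ∷ p ∣ ≡ indicator x + ∣ p ∣
∣x∷p∣≡indicator[x]+∣p∣ true  p = refl
∣x∷p∣≡indicator[x]+∣p∣ false p = refl

⌊suc≟suc⌋ : ∀ {t} (j i : Fin t) → ⌊ suc j ≟ suc i ⌋ ≡ ⌊ j ≟ i ⌋
⌊suc≟suc⌋ j i with j ≟ i
... | yes _ = refl
... | no  _ = refl

∑-indicator-≟ : ∀ {t} (j : Fin t) → ∑[ i < t ] indicator ⌊ j ≟ i ⌋ ≡ 1
∑-indicator-≟ {suc t} zero    = cong suc (sum-replicate-zero t)
∑-indicator-≟ {suc t} (suc j) =
  trans (sum-cong-≗ (cong indicator ∘ ⌊suc≟suc⌋ j)) (∑-indicator-≟ j)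

∑-∣fibre∣≡n : ∀ {n t} (c : Fin n → Fin t) → ∑[ i < t ] ∣ tabulate (λ v → ⌊ c v ≟ i ⌋) ∣ ≡ n
∑-∣fibre∣≡n {zero}  {t} c = sum-replicate-zero t
∑-∣fibre∣≡n {suc n} {t} c = begin
  ∑[ i < t ] ∣ ⌊ c zero ≟ i ⌋ ∷ fibre′ i ∣
    ≡⟨ sum-cong-≗ (λ i → ∣x∷p∣≡indicator[x]+∣p∣ _ (fibre′ i)) ⟩
  ∑[ i < t ] (indicator ⌊ c zero ≟ i ⌋ + ∣ fibre′ i ∣)
    ≡⟨ ∑-distrib-+ (indicator ∘ ⌊_⌋ ∘ (c zero ≟_)) (∣_∣ ∘ fibre′) ⟩
  ∑[ i < t ] indicator ⌊ c zero ≟ i ⌋ + ∑[ i < t ] ∣ fibre′ i ∣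
    ≡⟨ cong₂ _+_ (∑-indicator-≟ (c zero)) (∑-∣fibre∣≡n (c ∘ suc)) ⟩
  suc n
    ∎
  where
  open ≡-Reasoning
  fibre′ : Fin t → Subset n
  fibre′ i = tabulate (λ v → ⌊ c (suc v) ≟ i ⌋)

∑-bounded : ∀ {t} (f : Fin t → ℕ) {a} → (∀ i → f i ≤ a) → ∑[ i < t ] f i ≤ t * a
∑-bounded {zero}  f f≤a = z≤n
∑-bounded {suc t} f f≤a = +-mono-≤ (f≤a zero) (∑-bounded (f ∘ suc) (f≤a ∘ suc))

module _ {n : ℕ} (G : Graph n) where
  open Graph G using (adj; irrefl)

  ∈N⇒Edge : ∀ {x z} → z ∈ N G x → Edge G x z
  ∈N⇒Edge {x} {z} z∈Nx = trans (sym (lookup∘tabulate (adj x) z)) ([]=⇒lookup z∈Nx)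

  freePartition⇒n≤t*ᾱ : ∀ {t a} → FreePartition G t →
    (∀ F → FreeIndependent G F → ∣ F ∣ ≤ a) → n ≤ t * a
  freePartition⇒n≤t*ᾱ {t} {a} (c , _ , free) ∣free∣≤a =
    subst (_≤ t * a) (∑-∣fibre∣≡n c) (∑-bounded _ (λ i → ∣free∣≤a (colourClass G c i) (free i)))

  distinctMaximal⇒∃∈∖ : ∀ {M₁ M₂} → MaximalIndependent G M₁ → MaximalIndependent G M₂ →
    M₁ ≢ M₂ → ∃ λ x → x ∈ M₁ × x ∉ M₂
  distinctMaximal⇒∃∈∖ {M₁} {M₂} (_ , maximal₁) (independent₂ , _) M₁≢M₂
    with any? (λ x → (x ∈? M₁) ×-dec ¬? (x ∈? M₂))
  ... | yes witness = witness
  ... | no ∄x = ⊥-elim (M₁≢M₂ (sym (maximal₁ M₂ independent₂ M₁⊆M₂)))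
    where
    M₁⊆M₂ : M₁ ⊆ M₂
    M₁⊆M₂ {x} x∈M₁ with x ∈? M₂
    ... | yes x∈M₂ = x∈M₂
    ... | no  x∉M₂ = ⊥-elim (∄x (x , x∈M₁ , x∉M₂))

  independent-∪⁅x⁆ : ∀ {M x} → Independent G M → (∀ y → y ∈ M → ¬ Edge G x y) →
    Independent G (M ∪ ⁅ x ⁆)
  independent-∪⁅x⁆ {M} {x} independent x≁M u v u∈ v∈
    with x∈p∪q⁻ M ⁅ x ⁆ u∈ | x∈p∪q⁻ M ⁅ x ⁆ v∈
  ... | inj₁ u∈M | inj₁ v∈M = independent u v u∈M v∈M
  ... | inj₁ u∈M | inj₂ v∈⁅x⁆ rewrite x∈⁅y⁆⇒x≡y x v∈⁅x⁆ = x≁M u u∈M ∘ trans (Graph.sym G x u)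
  ... | inj₂ u∈⁅x⁆ | inj₁ v∈M rewrite x∈⁅y⁆⇒x≡y x u∈⁅x⁆ = x≁M v v∈M
  ... | inj₂ u∈⁅x⁆ | inj₂ v∈⁅x⁆ rewrite x∈⁅y⁆⇒x≡y x u∈⁅x⁆ | x∈⁅y⁆⇒x≡y x v∈⁅x⁆ | irrefl x = λ ()

  maximal⇒dominating : ∀ {M x} → MaximalIndependent G M → x ∉ M → ∃ λ y → y ∈ M × Edge G x y
  maximal⇒dominating {M} {x} (independent , maximal) x∉M
    with any? (λ y → (y ∈? M) ×-dec (adj x y Bool.≟ true))
  ... | yes witness = witness
  ... | no ∄y = ⊥-elim (x∉M (subst (x ∈_) M∪⁅x⁆≡M (q⊆p∪q M ⁅ x ⁆ (x∈⁅x⁆ x))))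
    where
    M∪⁅x⁆≡M : M ∪ ⁅ x ⁆ ≡ M
    M∪⁅x⁆≡M = maximal (M ∪ ⁅ x ⁆)
      (independent-∪⁅x⁆ independent (λ y y∈M xy → ∄y (y , y∈M , xy))) (p⊆p∪q ⁅ x ⁆)

  independent-∉N : ∀ {M x z} → Independent G M → x ∈ M → z ∈ M → z ∉ N G x
  independent-∉N independent x∈M z∈M z∈Nx = independent _ _ x∈M z∈M (∈N⇒Edge z∈Nx)

  free⇒avoidsEdgeNeighbourhood : ∀ {F} → FreeIndependent G F →
    ∃ λ x → ∃ λ y → Edge G x y × F ⊆ ∁ (N G x ∪ N G y)
  free⇒avoidsEdgeNeighbourhood {F} (_ , M₁ , M₂ , max₁ , max₂ , M₁≢M₂ , F⊆M₁ , F⊆M₂)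
    with distinctMaximal⇒∃∈∖ max₁ max₂ M₁≢M₂
  ... | x , x∈M₁ , x∉M₂ with maximal⇒dominating max₂ x∉M₂
  ... | y , y∈M₂ , xy = x , y , xy , x∉p⇒x∈∁p ∘ avoids
    where
    avoids : ∀ {z} → z ∈ F → z ∉ N G x ∪ N G y
    avoids z∈F z∈N with x∈p∪q⁻ (N G x) (N G y) z∈N
    ... | inj₁ z∈Nx = independent-∉N (proj₁ max₁) x∈M₁ (F⊆M₁ z∈F) z∈Nx
    ... | inj₂ z∈Ny = independent-∉N (proj₁ max₂) y∈M₂ (F⊆M₂ z∈F) z∈Ny

  ∣free∣≤n∸d : ∀ {F δ} → FreeIndependent G F → IsMinEdgeDeg G δ → ∣ F ∣ ≤ n ∸ δ
  ∣free∣≤n∸d {F} {δ} free (_ , δ≤d) with free⇒avoidsEdgeNeighbourhood free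
  ... | x , y , xy , F⊆∁N = begin
    ∣ F ∣                  ≤⟨ p⊆q⇒∣p∣≤∣q∣ F⊆∁N ⟩
    ∣ ∁ (N G x ∪ N G y) ∣  ≡⟨ ∣∁p∣≡n∸∣p∣ (N G x ∪ N G y) ⟩
    n ∸ edgeDeg G x y      ≤⟨ ∸-monoʳ-≤ n (δ≤d x y xy) ⟩
    n ∸ δ                  ∎
    where open ≤-Reasoning

mainTheorem3 : (n : ℕ) (G : Graph n) (a δ : ℕ) →
    IsFreeIndepNumber G a → IsMinEdgeDeg G δ →
    (∀ t → IsFreeChromaticNumber G t → n ≤ t * a) × (n * a ≤ n * (n ∸ δ))
mainTheorem3 n G a δ ((F , free , ∣F∣≡a) , ∣free∣≤a) d =
  (λ t (partition , _) → freePartition⇒n≤t*ᾱ G partition ∣free∣≤a) ,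
  *-monoʳ-≤ n (subst (_≤ n ∸ δ) ∣F∣≡a (∣free∣≤n∸d G free d))
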